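{- Let $\varphi\colon\mathcal{A}\to\mathcal{A}^*$ be a substitution. There exists an integer $m\ge1$ such that $\varphi^m$ is idempotent.
   Context: $\mathcal{A}$ is a finite alphabet; a substitution $\psi\colon\mathcal{A}\to\mathcal{A}^*$ is extended by concatenation and assumed growing ($|\psi^n(a)|\to\infty$ for all $a$). Write $a\sim b$ (for $\psi$) if each of $a,b$ occurs in $\psi^n$ of the other for some $n\ge0$. A letter $a$ is ample if it occurs in $\psi^n(a)$ for some $n\ge1$; $\mathcal{A}'$ is the set of ample letters; for $a\in\mathcal{A}'$, $\lambda_\psi(a)$ is the letter equivalent to $a$ occurring in $\psi(a)$ at the last position among all letters equivalent to $a$. A letter $a$ is prolongable if it is the first letter of $\psi(a)$. $\psi$ is idempotent if: (1) for all $a\in\mathcal{A}$ and $n\ge1$ the set of letters occurring in $\psi(a)$ equals the set of letters occurring in $\psi^n(a)$; (2) for all $a$ and $n\ge1$ the set of letters occurring at least twice in $\psi(a)$ equals that for $\psi^n(a)$; (3) for all $a$ the first letter of $\psi(a)$ is prolongable; (4) $\lambda_\psi\colon\mathcal{A}'\to\mathcal{A}'$ satisfies $\lambda_\psi\circ\lambda_\psi=\lambda_\psi$. -}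

module Defs where

open import Data.Nat using (ℕ; zero; suc; _≤_; _<_)
open import Data.Fin using (Fin; _≟_) renaming (_<_ to _<ᶠ_)
open import Data.List using (List; []; _∷_; [_]; concatMap; length; lookup; head; filter)
open import Data.List.Membership.Propositional using (_∈_)
open import Data.Maybe using (just)
open import Data.Product using (Σ; ∃; ∃-syntax; _×_)
open import Relation.Binary.PropositionalEquality using (_≡_)
open import Relation.Nullary using (¬_)
open import Function.Bundles using (_⇔_)

-- The alphabet 𝒜 is Fin k (an arbitrary finite alphabet with k letters).
Subst : ℕ → Set
Subst k = Fin k → List (Fin k)

apply : ∀ {k} → Subst k → List (Fin k) → List (Fin k)
apply ψ w = concatMap ψ w

pow : ∀ {k} → Subst k → ℕ → Subst k
pow ψ zero    a = [ a ]
pow ψ (suc n) a = apply ψ (pow ψ n a)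

Growing : ∀ {k} → Subst k → Set
Growing {k} ψ = ∀ (a : Fin k) (N : ℕ) → ∃[ n ] (∀ m → n ≤ m → N ≤ length (pow ψ m a))

Equiv : ∀ {k} → Subst k → Fin k → Fin k → Set
Equiv ψ a b = (∃[ n ] (a ∈ pow ψ n b)) × (∃[ n ] (b ∈ pow ψ n a))

Ample : ∀ {k} → Subst k → Fin k → Set
Ample ψ a = ∃[ n ] (1 ≤ n × a ∈ pow ψ n a)

Prolongable : ∀ {k} → Subst k → Fin k → Set
Prolongable ψ a = head (ψ a) ≡ just a

OccursTwice : ∀ {k} → Fin k → List (Fin k) → Set
OccursTwice b w = 2 ≤ length (filter (b ≟_) w)

-- IsLambda ψ a b : b = λ_ψ(a), i.e. b is the letter equivalent to a occurring
-- in ψ(a) at the last position among all letters equivalent to a.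
IsLambda : ∀ {k} → Subst k → Fin k → Fin k → Set
IsLambda ψ a b =
  Σ (Fin (length (ψ a))) λ i →
    (lookup (ψ a) i ≡ b) × Equiv ψ b a ×
    (∀ (j : Fin (length (ψ a))) → i <ᶠ j → ¬ Equiv ψ (lookup (ψ a) j) a)

record Idempotent {k} (ψ : Subst k) : Set where
  field
    sameLetters : ∀ (a : Fin k) (n : ℕ) → 1 ≤ n →
      ∀ (b : Fin k) → (b ∈ ψ a) ⇔ (b ∈ pow ψ n a)
    sameTwice : ∀ (a : Fin k) (n : ℕ) → 1 ≤ n →
      ∀ (b : Fin k) → OccursTwice b (ψ a) ⇔ OccursTwice b (pow ψ n a)
    firstProlongable : ∀ (a b : Fin k) → head (ψ a) ≡ just b → Prolongable ψ b
    lambdaIdem : ∀ (a b c : Fin k) → Ample ψ a →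
      IsLambda ψ a b → IsLambda ψ b c → c ≡ b

-- Each condition for ψ = φᵐ to be idempotent is read off a finite profile of the powers of φ
-- that is compatible with composition: the multiplicities of letters in φⁿ(a) saturated at 2,
-- the first letter of φⁿ(a) and, once the letter sets have stabilised, the map a ↦ λ(a). For
-- such a profile sₙ, s_i = s_j implies s_(i+t) = s_(j+t); by pigeonhole the sequence is
-- eventually periodic, so s_(rM) = s_M for all r ≥ 1 at some M, and then at every multiple of
-- M. Stabilising the three profiles in turn gives m. For λ, take θ = φᴹ with stable letter
-- sets: for ample a, b ∼ a under any power of θ means that a and b occur in each other's
-- θ-images, and λ of θ^(i+t) is λ of θ^t followed by λ of θ^i, so stability yields λ ∘ λ = λ.
module Submission where

open import Defs
open import Data.Bool using (if_then_else_)
open import Data.Empty using (⊥-elim)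
open import Data.Fin using (Fin; zero; suc; toℕ; funToFin; finToFun; _≟_) renaming (_<_ to _<ᶠ_)
open import Data.Fin.Properties using (pigeonhole; finToFun-funToFin; suc-injective)
open import Data.Fin.Patterns using (0F; 1F; 2F)
open import Data.List using (List; []; _∷_; [_]; _++_; concatMap; length; filter; head; lookup)
open import Data.List.Effectful using (module MonadProperties)
open import Data.List.Membership.Propositional using (_∈_; lose)
open import Data.List.Membership.Propositional.Properties using (∈-concatMap⁺)
open import Data.List.Properties using (concatMap-pure; concatMap-cong; filter-++; length-++)
open import Data.List.Relation.Unary.Any using (here; there; index)
open import Data.List.Relation.Unary.Any.Properties using (lookup-index)
open import Data.Maybe using (Maybe; just; nothing; maybe; _>>=_; _<∣>_)
open import Data.Maybe.Properties using (<∣>-assoc; <∣>-identityʳ; just-injective)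
open import Data.Nat using (ℕ; zero; suc; _+_; _*_; _^_; _∸_; _≤_; z≤n; s≤s)
open import Data.Nat.Properties using (+-identityʳ; +-assoc; +-suc; *-assoc; *-distribʳ-+; m+[n∸m]≡n; n<1+n; m≤m+n; ≤-trans)
open import Data.Nat.Tactic.RingSolver using (solve-∀)
open import Data.Product using (_×_; _,_; proj₁; proj₂; map₁; ∃-syntax)
open import Data.Sum using (_⊎_; inj₁; inj₂)
open import Function using (_∘_; const)
open import Function.Bundles using (_⇔_; mk⇔; Equivalence)
import Function.Properties.Equivalence as ⇔
open import Function.Indexed.Relation.Binary.Equality using (≡-setoid)
open import Level using (0ℓ)
open import Relation.Binary.Bundles using (Setoid)
import Relation.Binary.Indexed.Heterogeneous.Construct.Trivial as Trivial
open import Relation.Binary.PropositionalEquality as ≡ using (_≡_; _≢_; _≗_; refl; cong; cong₂; subst; _→-setoid_)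
open import Relation.Nullary using (¬_; yes; no; does; _×-dec_)
open import Relation.Unary using (Decidable)

module SetoidSequence {c ℓ} (S : Setoid c ℓ) where
  open Setoid S
  open import Relation.Binary.Reasoning.Setoid S

  ShiftCompatible : (ℕ → Carrier) → Set ℓ
  ShiftCompatible s = ∀ t {i j} → s i ≈ s j → s (i + t) ≈ s (j + t)

  Stable : (ℕ → Carrier) → ℕ → Set ℓ
  Stable s M = ∀ r → s (suc r * M) ≈ s M

  module _ {s : ℕ → Carrier} where

    stable-* : ∀ {M} → Stable s M → ∀ c → Stable s (suc c * M)
    stable-* {M} stable c r = begin
      s (suc r * (suc c * M))     ≡⟨ cong s (≡.sym (*-assoc (suc r) (suc c) M)) ⟩
      s (suc (c + r * suc c) * M) ≈⟨ stable (c + r * suc c) ⟩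
      s M                         ≈⟨ stable c ⟨
      s (suc c * M)               ∎

    stable-twice : ∀ {M} → Stable s M → s (M + M) ≈ s M
    stable-twice {M} stable =
      trans (reflexive (cong (λ n → s (M + n)) (≡.sym (+-identityʳ M)))) (stable 1)

    shiftCompatible-* : ShiftCompatible s → ∀ M → ShiftCompatible (λ n → s (n * M))
    shiftCompatible-* shift M t {i} {j} eq = begin
      s ((i + t) * M)   ≡⟨ cong s (*-distribʳ-+ M i t) ⟩
      s (i * M + t * M) ≈⟨ shift (t * M) eq ⟩
      s (j * M + t * M) ≡⟨ cong s (*-distribʳ-+ M j t) ⟨
      s ((j + t) * M)   ∎

    stable-∘* : ∀ {M c} → Stable (λ n → s (n * M)) c → Stable s (c * M)
    stable-∘* {M} {c} stable r =
      trans (reflexive (cong s (≡.sym (*-assoc (suc r) c M)))) (stable r)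

    periodic : ShiftCompatible s → ∀ {i d} → s (i + d) ≈ s i →
               ∀ t q → s (i + t + q * d) ≈ s (i + t)
    periodic shift {i} {d} period t zero = reflexive (cong s (+-identityʳ (i + t)))
    periodic shift {i} {d} period t (suc q) = begin
      s (i + t + (d + q * d)) ≡⟨ cong s (reorder i t d (q * d)) ⟩
      s (i + d + (t + q * d)) ≈⟨ shift (t + q * d) period ⟩
      s (i + (t + q * d))     ≡⟨ cong s (≡.sym (+-assoc i t (q * d))) ⟩
      s (i + t + q * d)       ≈⟨ periodic shift period t q ⟩
      s (i + t)               ∎
      where
      reorder : ∀ i t d e → i + t + (d + e) ≡ i + d + (t + e)
      reorder = solve-∀

  module Finite {N} (enc : Carrier → Fin N) (enc-injective : ∀ {x y} → enc x ≡ enc y → x ≈ y) where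

    ∃-recurrence : ∀ (s : ℕ → Carrier) → ∃[ i ] ∃[ p ] s (i + suc p) ≈ s i
    ∃-recurrence s with i , j , i<j , eq ← pigeonhole (n<1+n N) (λ n → enc (s (toℕ n))) =
      toℕ i , toℕ j ∸ suc (toℕ i) , trans (reflexive (cong s i+d≡j)) (sym (enc-injective eq))
      where
      i+d≡j : toℕ i + suc (toℕ j ∸ suc (toℕ i)) ≡ toℕ j
      i+d≡j = ≡.trans (+-suc (toℕ i) _) (m+[n∸m]≡n i<j)

    -- The index (1 + p)(1 + i) is a multiple of the period that lies beyond the preperiod.
    ∃-stable : ∀ {s} → ShiftCompatible s → ∃[ m ] Stable s (suc m)
    ∃-stable {s} shift with i , p , period ← ∃-recurrence s =
      p + i * suc p , λ r → begin
        s (suc r * suc (p + i * suc p))            ≡⟨ cong s (unfold r i p) ⟩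
        s (i + (suc p + i * p) + r * suc i * suc p) ≈⟨ periodic {s} shift period (suc p + i * p) (r * suc i) ⟩
        s (i + (suc p + i * p))                    ≡⟨ cong s (fold i p) ⟩
        s (suc (p + i * suc p))                    ∎
      where
      unfold : ∀ r i p → suc r * suc (p + i * suc p) ≡ i + (suc p + i * p) + r * suc i * suc p
      unfold = solve-∀
      fold : ∀ i p → i + (suc p + i * p) ≡ suc (p + i * suc p)
      fold = solve-∀

    ∃-stable-multiple : ∀ {s} → ShiftCompatible s → ∀ M → ∃[ c ] Stable s (suc c * M)
    ∃-stable-multiple {s} shift M with c , stable ← ∃-stable {λ n → s (n * M)} (shiftCompatible-* {s} shift M) =
      c , stable-∘* {s} {M} {suc c} stable

funToFin-injective : ∀ {m n} {f g : Fin m → Fin n} → funToFin f ≡ funToFin g → f ≗ g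
funToFin-injective {f = f} {g} eq x = begin
  f x                     ≡⟨ finToFun-funToFin f x ⟨
  finToFun (funToFin f) x ≡⟨ cong (λ c → finToFun c x) eq ⟩
  finToFun (funToFin g) x ≡⟨ finToFun-funToFin g x ⟩
  g x                     ∎
  where open ≡.≡-Reasoning

maybeToFin : ∀ {n} → Maybe (Fin n) → Fin (suc n)
maybeToFin = maybe suc zero

maybeToFin-injective : ∀ {n} {x y : Maybe (Fin n)} → maybeToFin x ≡ maybeToFin y → x ≡ y
maybeToFin-injective {x = just x}  {just y}  eq   = cong just (suc-injective eq)
maybeToFin-injective {x = nothing} {nothing} refl = refl

module _ {k : ℕ} where

  apply-[_] : (w : List (Fin k)) → apply [_] w ≡ w
  apply-[_] = concatMap-pure

  apply-apply : (f g : Subst k) (w : List (Fin k)) → apply f (apply g w) ≡ apply (apply f ∘ g) w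
  apply-apply f g w = ≡.sym (MonadProperties.associative w g f)

  pow-+ : (φ : Subst k) (i t : ℕ) (a : Fin k) → pow φ (i + t) a ≡ apply (pow φ i) (pow φ t a)
  pow-+ φ zero    t a = ≡.sym (apply-[ pow φ t a ])
  pow-+ φ (suc i) t a =
    ≡.trans (cong (apply φ) (pow-+ φ i t a)) (apply-apply φ (pow φ i) (pow φ t a))

  pow-* : (φ : Subst k) (M n : ℕ) (a : Fin k) → pow (pow φ M) n a ≡ pow φ (n * M) a
  pow-* φ M zero    a = refl
  pow-* φ M (suc n) a =
    ≡.trans (cong (apply (pow φ M)) (pow-* φ M n a)) (≡.sym (pow-+ φ M (n * M) a))

  pow-cong : {φ ψ : Subst k} → φ ≗ ψ → ∀ n a → pow φ n a ≡ pow ψ n a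
  pow-cong φ≗ψ zero    a = refl
  pow-cong φ≗ψ (suc n) a =
    ≡.trans (concatMap-cong φ≗ψ (pow _ n a)) (cong (apply _) (pow-cong φ≗ψ n a))

  ∈-apply : {g : Subst k} {w : List (Fin k)} {x y : Fin k} → y ∈ w → x ∈ g y → x ∈ apply g w
  ∈-apply {g} y∈w x∈gy = ∈-concatMap⁺ g (lose y∈w x∈gy)

  NonErasing : Subst k → Set
  NonErasing φ = ∀ a → φ a ≢ []

  head-apply : {g : Subst k} → NonErasing g → (w : List (Fin k)) →
               head (apply g w) ≡ (head w >>= head ∘ g)
  head-apply         ne []      = refl
  head-apply {g = g} ne (x ∷ w) with g x | ne x
  ... | []    | gx≢[] = ⊥-elim (gx≢[] refl)
  ... | _ ∷ _ | _     = refl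

  apply-nonErasing : {g : Subst k} → NonErasing g → (w : List (Fin k)) → w ≢ [] → apply g w ≢ []
  apply-nonErasing         ne []      w≢[] = w≢[]
  apply-nonErasing {g = g} ne (x ∷ w) _    with g x | ne x
  ... | []    | gx≢[] = λ _ → gx≢[] refl
  ... | _ ∷ _ | _     = λ ()

  pow-nonErasing : {φ : Subst k} → NonErasing φ → ∀ n → NonErasing (pow φ n)
  pow-nonErasing ne zero    a = λ ()
  pow-nonErasing ne (suc n) a = apply-nonErasing ne (pow _ n a) (pow-nonErasing ne n a)

  growing⇒nonErasing : (φ : Subst k) → Growing φ → NonErasing φ
  growing⇒nonErasing φ growing a φa≡[] with n , long ← growing a 1
    with subst (λ w → 1 ≤ length w) erased (long (n + 1) (m≤m+n n 1))
    where
    erased : pow φ (n + 1) a ≡ []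
    erased = ≡.trans (pow-+ φ n 1 a) (cong (apply (pow φ n)) (cong (_++ []) φa≡[]))
  ... | ()

-- Multiplicities saturated at 2 still add, and they tell "absent", "once" and "twice" apart.
cap : ℕ → Fin 3
cap 0             = 0F
cap 1             = 1F
cap (suc (suc _)) = 2F

_⊕_ : Fin 3 → Fin 3 → Fin 3
0F ⊕ y  = y
x  ⊕ 0F = x
_  ⊕ _  = 2F

cap-+ : ∀ m n → cap (m + n) ≡ cap m ⊕ cap n
cap-+ 0             n             = refl
cap-+ 1             0             = refl
cap-+ 1             1             = refl
cap-+ 1             (suc (suc n)) = refl
cap-+ (suc (suc m)) 0             = refl
cap-+ (suc (suc m)) 1             = refl
cap-+ (suc (suc m)) (suc (suc n)) = refl

cap-≤ : ∀ {j} n → j ≤ 2 → j ≤ n ⇔ j ≤ toℕ (cap n)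
cap-≤ 0             _   = ⇔.refl
cap-≤ 1             _   = ⇔.refl
cap-≤ (suc (suc n)) j≤2 = mk⇔ (const j≤2) (λ _ → ≤-trans j≤2 (s≤s (s≤s z≤n)))

module _ {k : ℕ} where

  count : Fin k → List (Fin k) → ℕ
  count b w = length (filter (b ≟_) w)

  count-++ : ∀ b xs ys → count b (xs ++ ys) ≡ count b xs + count b ys
  count-++ b xs ys = ≡.trans (cong length (filter-++ (b ≟_) xs ys)) (length-++ (filter (b ≟_) xs))

  ∈⇔1≤count : ∀ {b} w → b ∈ w ⇔ 1 ≤ count b w
  ∈⇔1≤count {b} w = mk⇔ (to w) (from w)
    where
    to : ∀ w → b ∈ w → 1 ≤ count b w
    to (x ∷ w) b∈ with b ≟ x | b∈
    ... | yes _   | _          = s≤s z≤n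
    ... | no  b≢x | here b≡x   = ⊥-elim (b≢x b≡x)
    ... | no  _   | there b∈w = to w b∈w
    from : ∀ w → 1 ≤ count b w → b ∈ w
    from (x ∷ w) 1≤c with b ≟ x
    ... | yes b≡x = here b≡x
    ... | no  _   = there (from w 1≤c)

  cappedCount : Fin k → List (Fin k) → Fin 3
  cappedCount b w = cap (count b w)

  cappedCount-++ : ∀ b xs ys → cappedCount b (xs ++ ys) ≡ cappedCount b xs ⊕ cappedCount b ys
  cappedCount-++ b xs ys = ≡.trans (cong cap (count-++ b xs ys)) (cap-+ (count b xs) (count b ys))

  cappedCount-apply-cong : ∀ b {g h : Subst k} → (∀ x → cappedCount b (g x) ≡ cappedCount b (h x)) →
                           ∀ w → cappedCount b (apply g w) ≡ cappedCount b (apply h w)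
  cappedCount-apply-cong b         eq []      = refl
  cappedCount-apply-cong b {g} {h} eq (x ∷ w) = begin
    cappedCount b (g x ++ apply g w)                   ≡⟨ cappedCount-++ b (g x) (apply g w) ⟩
    cappedCount b (g x) ⊕ cappedCount b (apply g w)    ≡⟨ cong₂ _⊕_ (eq x) (cappedCount-apply-cong b eq w) ⟩
    cappedCount b (h x) ⊕ cappedCount b (apply h w)    ≡⟨ cappedCount-++ b (h x) (apply h w) ⟨
    cappedCount b (h x ++ apply h w)                   ∎
    where open ≡.≡-Reasoning

  cappedCount-≡⇒≤count⇔ : ∀ {j b w w′} → j ≤ 2 → cappedCount b w ≡ cappedCount b w′ →
                          j ≤ count b w ⇔ j ≤ count b w′
  cappedCount-≡⇒≤count⇔ {b = b} {w} {w′} j≤2 eq = ⇔.trans (cap-≤ (count b w) j≤2)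
    (subst (λ c → _ ≤ toℕ c ⇔ _) (≡.sym eq) (⇔.sym (cap-≤ (count b w′) j≤2)))

module _ {A : Set} {P : A → Set} (P? : Decidable P) where

  findLast : List A → Maybe A
  findLast []       = nothing
  findLast (x ∷ xs) = findLast xs <∣> (if does (P? x) then just x else nothing)

  findLast-++ : ∀ xs ys → findLast (xs ++ ys) ≡ (findLast ys <∣> findLast xs)
  findLast-++ []       ys = ≡.sym (<∣>-identityʳ (findLast ys))
  findLast-++ (x ∷ xs) ys =
    ≡.trans (cong (_<∣> _) (findLast-++ xs ys)) (<∣>-assoc (findLast ys) (findLast xs) _)

  findLast-just : ∀ {y} xs → findLast xs ≡ just y → y ∈ xs × P y
  findLast-just (x ∷ xs) eq with findLast xs in eq′ | P? x
  ... | just z  | _        with refl ← eq = map₁ there (findLast-just xs eq′)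
  ... | nothing | yes px   with refl ← eq = here refl , px

  findLast-none : ∀ xs → (∀ {y} → y ∈ xs → ¬ P y) → findLast xs ≡ nothing
  findLast-none []       none = refl
  findLast-none (x ∷ xs) none with P? x
  ... | yes px = ⊥-elim (none (here refl) px)
  ... | no  _  = ≡.trans (<∣>-identityʳ (findLast xs)) (findLast-none xs (none ∘ there))

  findLast-some : ∀ {y} xs → y ∈ xs → P y → findLast xs ≢ nothing
  findLast-some (x ∷ xs) y∈ py found with findLast xs in eq | P? x | y∈
  findLast-some (x ∷ xs) y∈ py ()    | just _  | _      | _
  findLast-some (x ∷ xs) y∈ py ()    | nothing | yes _  | _
  findLast-some (x ∷ xs) y∈ py found | nothing | no ¬px | here refl  = ¬px py
  findLast-some (x ∷ xs) y∈ py found | nothing | no _   | there y∈xs = findLast-some xs y∈xs py eq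

  findLast-lookup : ∀ xs (i : Fin (length xs)) → P (lookup xs i) → (∀ j → i <ᶠ j → ¬ P (lookup xs j)) →
                    findLast xs ≡ just (lookup xs i)
  findLast-lookup (x ∷ xs) zero    px later with P? x
  ... | yes _  = cong (_<∣> just x)
                   (findLast-none xs λ y∈ → later (suc (index y∈)) (s≤s z≤n) ∘ subst P (lookup-index y∈))
  ... | no ¬px = ⊥-elim (¬px px)
  findLast-lookup (x ∷ xs) (suc i) pi later
    rewrite findLast-lookup xs i pi (λ j i<j → later (suc j) (s≤s i<j)) = refl

  findLast-concatMap : (g : A → List A) → ∀ w →
                       (∀ {x} → x ∈ w → ¬ P x → findLast (g x) ≡ nothing) →
                       (∀ {x} → x ∈ w → P x → findLast (g x) ≢ nothing) →
                       findLast (concatMap g w) ≡ (findLast w >>= findLast ∘ g)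
  findLast-concatMap g []      _    _    = refl
  findLast-concatMap g (x ∷ w) skip keep
    rewrite findLast-++ (g x) (concatMap g w) | findLast-concatMap g w (skip ∘ there) (keep ∘ there)
    with findLast w in eq
  ... | just y with findLast (g y) | keep (there (proj₁ (findLast-just w eq))) (proj₂ (findLast-just w eq))
  ...   | just _  | _     = refl
  ...   | nothing | found = ⊥-elim (found refl)
  findLast-concatMap g (x ∷ w) skip keep | nothing with P? x
  ...   | yes _  = refl
  ...   | no ¬px = skip (here refl) ¬px

findLast-cong : ∀ {A : Set} {P Q : A → Set} (P? : Decidable P) (Q? : Decidable Q) → (∀ x → P x ⇔ Q x) →
                ∀ xs → findLast P? xs ≡ findLast Q? xs
findLast-cong P? Q? P⇔Q []       = refl
findLast-cong P? Q? P⇔Q (x ∷ xs) with P? x | Q? x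
... | yes _  | yes _  = cong (_<∣> just x) (findLast-cong P? Q? P⇔Q xs)
... | no _   | no _   = cong (_<∣> nothing) (findLast-cong P? Q? P⇔Q xs)
... | yes px | no ¬qx = ⊥-elim (¬qx (Equivalence.to (P⇔Q x) px))
... | no ¬px | yes qx = ⊥-elim (¬px (Equivalence.from (P⇔Q x) qx))

>>=-cong : ∀ {A B : Set} {mx : Maybe A} {f g : A → Maybe B} →
           (∀ {y} → mx ≡ just y → f y ≡ g y) → (mx >>= f) ≡ (mx >>= g)
>>=-cong {mx = nothing} _  = refl
>>=-cong {mx = just y}  eq = eq refl

LetterMaps : ℕ → Setoid 0ℓ 0ℓ
LetterMaps k = Fin k →-setoid Maybe (Fin k)

CountProfiles : ℕ → Setoid 0ℓ 0ℓ
CountProfiles k = ≡-setoid (Fin k) (Trivial.indexedSetoid (Fin k →-setoid Fin 3))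

module _ {k : ℕ} where

  letterMap-code : (Fin k → Maybe (Fin k)) → Fin (suc k ^ k)
  letterMap-code f = funToFin (maybeToFin ∘ f)

  letterMap-code-injective : ∀ {f g} → letterMap-code f ≡ letterMap-code g → f ≗ g
  letterMap-code-injective eq a = maybeToFin-injective (funToFin-injective eq a)

  countProfile-code : (Fin k → Fin k → Fin 3) → Fin ((3 ^ k) ^ k)
  countProfile-code f = funToFin (funToFin ∘ f)

  countProfile-code-injective : ∀ {f g} → countProfile-code f ≡ countProfile-code g → ∀ a → f a ≗ g a
  countProfile-code-injective eq a = funToFin-injective (funToFin-injective eq a)

module Letters {k : ℕ} where
  open SetoidSequence (LetterMaps k) public
  open Finite letterMap-code letterMap-code-injective public

module Counts {k : ℕ} where
  open SetoidSequence (CountProfiles k) public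
  open Finite countProfile-code countProfile-code-injective public

module _ {k : ℕ} where

  >>=-shiftCompatible : (s : ℕ → Fin k → Maybe (Fin k)) → (∀ i t a → s (i + t) a ≡ (s t a >>= s i)) →
                        Letters.ShiftCompatible s
  >>=-shiftCompatible s s-+ t {i} {j} eq a = begin
    s (i + t) a       ≡⟨ s-+ i t a ⟩
    (s t a >>= s i)   ≡⟨ >>=-cong {mx = s t a} (λ {x} _ → eq x) ⟩
    (s t a >>= s j)   ≡⟨ s-+ j t a ⟨
    s (j + t) a       ∎
    where open ≡.≡-Reasoning

  SameLetters : Subst k → Set
  SameLetters ψ = ∀ (a : Fin k) (n : ℕ) → 1 ≤ n → ∀ (b : Fin k) → (b ∈ ψ a) ⇔ (b ∈ pow ψ n a)

  SameTwice : Subst k → Set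
  SameTwice ψ = ∀ (a : Fin k) (n : ℕ) → 1 ≤ n → ∀ (b : Fin k) → OccursTwice b (ψ a) ⇔ OccursTwice b (pow ψ n a)

  FirstProlongable : Subst k → Set
  FirstProlongable ψ = ∀ (a b : Fin k) → head (ψ a) ≡ just b → Prolongable ψ b

  LambdaIdempotent : Subst k → Set
  LambdaIdempotent ψ = ∀ (a b c : Fin k) → Ample ψ a → IsLambda ψ a b → IsLambda ψ b c → c ≡ b

isLambda⇒findLast : ∀ {k} {ψ : Subst k} {a b} {P : Fin k → Set} (P? : Decidable P) →
                    (∀ x → Equiv ψ x a ⇔ P x) → IsLambda ψ a b → findLast P? (ψ a) ≡ just b
isLambda⇒findLast {ψ = ψ} {a} P? equiv⇔P (i , refl , b∼a , later) =
  findLast-lookup P? (ψ a) i (Equivalence.to (equiv⇔P _) b∼a) (λ j i<j → later j i<j ∘ Equivalence.from (equiv⇔P _))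

module Profiles {k} (φ : Subst k) where

  countProfile : ℕ → Fin k → Fin k → Fin 3
  countProfile n a b = cappedCount b (pow φ n a)

  countProfile-shiftCompatible : Counts.ShiftCompatible countProfile
  countProfile-shiftCompatible t {i} {j} eq a b = begin
    cappedCount b (pow φ (i + t) a)             ≡⟨ cong (cappedCount b) (pow-+ φ i t a) ⟩
    cappedCount b (apply (pow φ i) (pow φ t a)) ≡⟨ cappedCount-apply-cong b (λ x → eq x b) (pow φ t a) ⟩
    cappedCount b (apply (pow φ j) (pow φ t a)) ≡⟨ cong (cappedCount b) (pow-+ φ j t a) ⟨
    cappedCount b (pow φ (j + t) a)             ∎
    where open ≡.≡-Reasoning

  firstLetter : ℕ → Fin k → Maybe (Fin k)
  firstLetter n a = head (pow φ n a)

  firstLetter-+ : NonErasing φ → ∀ i t a → firstLetter (i + t) a ≡ (firstLetter t a >>= firstLetter i)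
  firstLetter-+ ne i t a =
    ≡.trans (cong head (pow-+ φ i t a)) (head-apply (pow-nonErasing ne i) (pow φ t a))

  firstLetter-shiftCompatible : NonErasing φ → Letters.ShiftCompatible firstLetter
  firstLetter-shiftCompatible ne = >>=-shiftCompatible firstLetter (firstLetter-+ ne)

  module _ {M} (stable : Counts.Stable countProfile M) where

    ≤count⇔ : ∀ {j} → j ≤ 2 → ∀ a r b → j ≤ count b (pow φ M a) ⇔ j ≤ count b (pow (pow φ M) (suc r) a)
    ≤count⇔ j≤2 a r b rewrite pow-* φ M (suc r) a =
      cappedCount-≡⇒≤count⇔ {w = pow φ M a} {pow φ (suc r * M) a} j≤2 (≡.sym (stable r a b))

    stable⇒sameLetters : SameLetters (pow φ M)
    stable⇒sameLetters a (suc r) _ b = ⇔.trans (∈⇔1≤count (pow φ M a))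
      (⇔.trans (≤count⇔ (s≤s z≤n) a r b) (⇔.sym (∈⇔1≤count (pow (pow φ M) (suc r) a))))

    stable⇒sameTwice : SameTwice (pow φ M)
    stable⇒sameTwice a (suc r) _ b = ≤count⇔ (s≤s (s≤s z≤n)) a r b

  stable⇒firstProlongable : NonErasing φ → ∀ {M} → Letters.Stable firstLetter M → FirstProlongable (pow φ M)
  stable⇒firstProlongable ne {M} stable a b first≡b = begin
    firstLetter M b                    ≡⟨ cong (_>>= firstLetter M) first≡b ⟨
    (firstLetter M a >>= firstLetter M) ≡⟨ firstLetter-+ ne M M a ⟨
    firstLetter (M + M) a              ≡⟨ Letters.stable-twice {s = firstLetter} {M} stable a ⟩
    firstLetter M a                    ≡⟨ first≡b ⟩
    just b                             ∎
    where open ≡.≡-Reasoning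

module Lambda {k} (θ : Subst k) (θ-sameLetters : SameLetters θ) where

  open import Data.List.Membership.DecPropositional (_≟_ {k}) using (_∈?_)

  ∈θ-trans : ∀ {x y z} → y ∈ θ x → z ∈ θ y → z ∈ θ x
  ∈θ-trans {x} y∈θx z∈θy = Equivalence.from (θ-sameLetters x 2 (s≤s z≤n) _)
    (∈-apply (Equivalence.to (θ-sameLetters x 1 (s≤s z≤n) _) y∈θx) z∈θy)

  ∈-pow⇒∈θ : ∀ n {x y} → y ∈ pow θ n x → y ≡ x ⊎ y ∈ θ x
  ∈-pow⇒∈θ zero    (here y≡x) = inj₁ y≡x
  ∈-pow⇒∈θ (suc n) y∈        = inj₂ (Equivalence.from (θ-sameLetters _ (suc n) (s≤s z≤n) _) y∈)

  ∈θ⇒∈-pow : ∀ n {x y} → y ∈ θ x → y ∈ pow θ (suc n) x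
  ∈θ⇒∈-pow n y∈θx = Equivalence.to (θ-sameLetters _ (suc n) (s≤s z≤n) _) y∈θx

  ample⇒∈-pow : ∀ n {x} → x ∈ θ x → x ∈ pow θ n x
  ample⇒∈-pow zero    _     = here refl
  ample⇒∈-pow (suc n) x∈θx = ∈θ⇒∈-pow n x∈θx

  Mutual : Fin k → Fin k → Set
  Mutual a x = x ∈ θ a × a ∈ θ x

  mutual? : ∀ a → Decidable (Mutual a)
  mutual? a x = x ∈? θ a ×-dec a ∈? θ x

  mutual⇒ample : ∀ {a x} → Mutual a x → x ∈ θ x
  mutual⇒ample (x∈θa , a∈θx) = ∈θ-trans a∈θx x∈θa

  mutual-transfer : ∀ {a x} → Mutual a x → ∀ y → Mutual a y ⇔ Mutual x y
  mutual-transfer (x∈θa , a∈θx) y = mk⇔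
    (λ (y∈θa , a∈θy) → ∈θ-trans a∈θx y∈θa , ∈θ-trans a∈θy x∈θa)
    (λ (y∈θx , x∈θy) → ∈θ-trans x∈θa y∈θx , ∈θ-trans x∈θy a∈θx)

  -- λ of θⁿ, computed with Mutual, which is ∼ of every power of θ on ample letters;
  -- nothing when a is not ample.
  lambda : ℕ → Fin k → Maybe (Fin k)
  lambda n a = findLast (mutual? a) (pow θ n a)

  mutual-descends : ∀ {a x y} i t → x ∈ pow θ t a → y ∈ pow θ i x → Mutual a y → Mutual a x
  mutual-descends {a} {x} {y} i t x∈ y∈ (y∈θa , a∈θy) =
    x∈θa (∈-pow⇒∈θ t x∈) , a∈θx (∈-pow⇒∈θ i y∈)
    where
    x∈θa : x ≡ a ⊎ x ∈ θ a → x ∈ θ a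
    x∈θa (inj₁ refl) = ∈θ-trans y∈θa a∈θy
    x∈θa (inj₂ x∈θa) = x∈θa
    a∈θx : y ≡ x ⊎ y ∈ θ x → a ∈ θ x
    a∈θx (inj₁ refl) = a∈θy
    a∈θx (inj₂ y∈θx) = ∈θ-trans y∈θx a∈θy

  lambda-+ : ∀ i t a → lambda (i + t) a ≡ (lambda t a >>= lambda i)
  lambda-+ i t a = begin
    findLast (mutual? a) (pow θ (i + t) a)
      ≡⟨ cong (findLast (mutual? a)) (pow-+ θ i t a) ⟩
    findLast (mutual? a) (apply (pow θ i) (pow θ t a))
      ≡⟨ findLast-concatMap (mutual? a) (pow θ i) (pow θ t a) skip keep ⟩
    (lambda t a >>= λ x → findLast (mutual? a) (pow θ i x))
      ≡⟨ >>=-cong {mx = lambda t a} transfer ⟩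
    (lambda t a >>= lambda i)
      ∎
    where
    open ≡.≡-Reasoning
    skip : ∀ {x} → x ∈ pow θ t a → ¬ Mutual a x → findLast (mutual? a) (pow θ i x) ≡ nothing
    skip x∈ ¬mutual = findLast-none (mutual? a) _ λ y∈ → ¬mutual ∘ mutual-descends i t x∈ y∈
    keep : ∀ {x} → x ∈ pow θ t a → Mutual a x → findLast (mutual? a) (pow θ i x) ≢ nothing
    keep _ m = findLast-some (mutual? a) _ (ample⇒∈-pow i (mutual⇒ample m)) m
    transfer : ∀ {x} → lambda t a ≡ just x → findLast (mutual? a) (pow θ i x) ≡ lambda i x
    transfer {x} eq = findLast-cong (mutual? a) (mutual? x)
      (mutual-transfer (proj₂ (findLast-just (mutual? a) (pow θ t a) eq))) (pow θ i x)

  lambda-shiftCompatible : Letters.ShiftCompatible lambda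
  lambda-shiftCompatible = >>=-shiftCompatible lambda lambda-+

  module _ {ψ : Subst k} (m : ℕ) (ψ≗θ^ : ψ ≗ pow θ (suc m)) where

    pow-ψ : ∀ n a → pow ψ n a ≡ pow θ (n * suc m) a
    pow-ψ n a = ≡.trans (pow-cong ψ≗θ^ n a) (pow-* θ (suc m) n a)

    ample⇒∈θ : ∀ {a} → Ample ψ a → a ∈ θ a
    ample⇒∈θ (suc n , _ , a∈) =
      Equivalence.from (θ-sameLetters _ (suc n * suc m) (s≤s z≤n) _) (subst (_ ∈_) (pow-ψ (suc n) _) a∈)

    equiv⇔mutual : ∀ {a} → a ∈ θ a → ∀ x → Equiv ψ x a ⇔ Mutual a x
    equiv⇔mutual {a} a∈θa x = mk⇔
      (λ ((n , x∈) , (n′ , a∈)) → into-θa (from-ψ n x∈) , a-into-θ (from-ψ n′ a∈))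
      (λ (x∈θa , a∈θx) → (1 , to-ψ x∈θa) , (1 , to-ψ a∈θx))
      where
      from-ψ : ∀ n {y z} → y ∈ pow ψ n z → y ≡ z ⊎ y ∈ θ z
      from-ψ n y∈ = ∈-pow⇒∈θ (n * suc m) (subst (_ ∈_) (pow-ψ n _) y∈)
      to-ψ : ∀ {y z} → y ∈ θ z → y ∈ pow ψ 1 z
      to-ψ y∈ = subst (_ ∈_) (≡.sym (pow-ψ 1 _)) (∈θ⇒∈-pow (m + 0) y∈)
      into-θa : ∀ {y} → y ≡ a ⊎ y ∈ θ a → y ∈ θ a
      into-θa (inj₁ refl) = a∈θa
      into-θa (inj₂ y∈θa) = y∈θa
      a-into-θ : ∀ {y} → a ≡ y ⊎ a ∈ θ y → a ∈ θ y
      a-into-θ (inj₁ refl) = a∈θa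
      a-into-θ (inj₂ a∈θy) = a∈θy

    isLambda⇒lambda : ∀ {a b} → a ∈ θ a → IsLambda ψ a b → lambda (suc m) a ≡ just b
    isLambda⇒lambda {a} a∈θa isλ = ≡.trans (cong (findLast (mutual? a)) (≡.sym (ψ≗θ^ a)))
                                           (isLambda⇒findLast (mutual? a) (equiv⇔mutual a∈θa) isλ)

    stable⇒lambdaIdempotent : Letters.Stable lambda (suc m) → LambdaIdempotent ψ
    stable⇒lambdaIdempotent stable a b c ample isλab@(_ , _ , b∼a , _) isλbc = just-injective (begin
      just c                                 ≡⟨ isLambda⇒lambda b∈θb isλbc ⟨
      lambda (suc m) b                       ≡⟨ cong (_>>= lambda (suc m)) λa≡b ⟨
      (lambda (suc m) a >>= lambda (suc m))  ≡⟨ lambda-+ (suc m) (suc m) a ⟨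
      lambda (suc m + suc m) a               ≡⟨ Letters.stable-twice {s = lambda} {suc m} stable a ⟩
      lambda (suc m) a                       ≡⟨ λa≡b ⟩
      just b                                 ∎)
      where
      open ≡.≡-Reasoning
      a∈θa = ample⇒∈θ ample
      λa≡b = isLambda⇒lambda a∈θa isλab
      b∈θb = mutual⇒ample (Equivalence.to (equiv⇔mutual a∈θa b) b∼a)

lemma1p8 : ∀ {k : ℕ} (φ : Subst k) → Growing φ →
    ∃[ m ] (1 ≤ m × Idempotent (pow φ m))
lemma1p8 φ growing =
  let open Profiles φ
      nonErasing = growing⇒nonErasing φ growing
      (c₁ , counts₁) = Counts.∃-stable {s = countProfile} countProfile-shiftCompatible
      (c₂ , firsts₂) = Letters.∃-stable-multiple {s = firstLetter} (firstLetter-shiftCompatible nonErasing) (suc c₁)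
      M₂ = suc c₂ * suc c₁
      counts₂ = Counts.stable-* {s = countProfile} {suc c₁} counts₁ c₂
      open Lambda (pow φ M₂) (stable⇒sameLetters {M₂} counts₂)
      (c₃ , lambdas) = Letters.∃-stable {s = lambda} lambda-shiftCompatible
      M = suc c₃ * M₂
      counts = Counts.stable-* {s = countProfile} {M₂} counts₂ c₃
  in M , s≤s z≤n , record
     { sameLetters      = stable⇒sameLetters {M} counts
     ; sameTwice        = stable⇒sameTwice {M} counts
     ; firstProlongable = stable⇒firstProlongable nonErasing {M} (Letters.stable-* {s = firstLetter} {M₂} firsts₂ c₃)
     ; lambdaIdem       = stable⇒lambdaIdempotent c₃ (λ a → ≡.sym (pow-* φ M₂ (suc c₃) a)) lambdas
     }
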